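{- Let $D$ be a GSHDS in a finite abelian group $G$, with $v=|G|$, $k=|D|$, and let $n_0$, $k_0$ be as in the definition. Let $A(D)$ be the $\mathbb Z$-span of $\{[1],D(x),D(x^{n_0})\}$ in $\mathbb Z[G]$. Then: (1) $A(D)$ is a $3$-dimensional association scheme (Schur ring) on $G$; (2) $k_0\in\{0,k\}$; (3) if $k_0=0$, then $D$ is a Paley type partial difference set with parameters $(v,\frac{v-1}{2},\frac{v-5}{4},\frac{v-1}{4})$; (4) if $k_0=k$, then $D$ is a skew Hadamard difference set with parameters $(v,\frac{v-1}{2},\frac{v-3}{4})$.
   Context: Group ring notation: for a finite abelian group $G$ (additive), $A(x)=\sum_g a_gx^g\in\mathbb Z[G]$, $[1]=x^0$, $G(x)=\sum_{g\in G}x^g$, $A(x^n)=\sum_g a_gx^{n\cdot g}$; for a subset $D$, $D(x)=\sum_{g\in D}x^g$, $D^{(n)}=\{n\cdot g:g\in D\}$. A GSHDS in $G$ is a subset $D\subseteq G$ such that for a fixed quadratic non-residue $n_0$ modulo $\exp(G)$ (an integer coprime to $\exp(G)$ that is not a square mod $\exp(G)$) and some integer $\lambda$: $D(x)+D(x^{n_0})=G(x)-[1]$ and $D(x)D(x^{n_0})=(k_0-\lambda)[1]+\lambda G(x)$, where $k_0=|D\cap D^{(-n_0)}|$. A partial difference set with parameters $(v,k,\lambda',\mu)$ is a $k$-subset $D$ of a group of order $v$ with $0\notin D$, $D^{(-1)}=D$ and $D(x)D(x^{ -1})=k[1]+\lambda'D(x)+\mu(G(x)-[1]-D(x))$. A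 skew Hadamard difference set with parameters $(v,k,\lambda)$ is a $k$-subset with $D(x)D(x^{ -1})=(k-\lambda)[1]+\lambda G(x)$ and $D(x)+D(x^{ -1})=G(x)-[1]$. -}

module Defs where

open import Data.Bool using (Bool; true; false; if_then_else_)
open import Data.Nat as ℕ using (ℕ; zero; suc)
open import Data.Nat.Coprimality using (Coprime)
open import Data.Integer as ℤ using (ℤ; +_; -[1+_]; ∣_∣)
open import Data.Integer.Divisibility using () renaming (_∣_ to _∣ℤ_)
open import Data.List using (List; length; filter)
open import Data.List.Membership.Propositional using (_∈_)
open import Data.List.Relation.Unary.Unique.Propositional using (Unique)
open import Data.Fin using (Fin)
open import Data.Product using (Σ; ∃; _×_; _,_)
open import Data.Sum using (_⊎_)
open import Relation.Nullary using (¬_; does)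
open import Relation.Binary.PropositionalEquality using (_≡_)
open import Relation.Binary.Definitions using (DecidableEquality)
open import Algebra.Structures using (IsAbelianGroup)

record FinAbGroup : Set₁ where
  field
    Carrier        : Set
    _≟_            : DecidableEquality Carrier
    _⊕_            : Carrier → Carrier → Carrier
    0g             : Carrier
    ⊖_             : Carrier → Carrier
    isAbelianGroup : IsAbelianGroup _≡_ _⊕_ 0g ⊖_
    elems          : List Carrier
    elems-unique   : Unique elems
    elems-complete : ∀ g → g ∈ elems

sumL : {A : Set} → List A → (A → ℤ) → ℤ
sumL List.[] f = + 0
sumL (x List.∷ xs) f = f x ℤ.+ sumL xs f

sumFin : (r : ℕ) → (Fin r → ℤ) → ℤ
sumFin zero f = + 0
sumFin (suc r) f = f Fin.zero ℤ.+ sumFin r (λ i → f (Fin.suc i))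

module _ (G : FinAbGroup) where
  open FinAbGroup G

  order : ℕ
  order = length elems

  _·ℕ_ : ℕ → Carrier → Carrier
  zero ·ℕ g = 0g
  suc n ·ℕ g = g ⊕ (n ·ℕ g)

  _·_ : ℤ → Carrier → Carrier
  (+ n) · g = n ·ℕ g
  -[1+ n ] · g = ⊖ (suc n ·ℕ g)

  IsExponent : ℕ → Set
  IsExponent e = (0 ℕ.< e) × (∀ g → e ·ℕ g ≡ 0g)
               × (∀ m → 0 ℕ.< m → (∀ g → m ·ℕ g ≡ 0g) → e ℕ.≤ m)

  IsQNR : ℤ → ℕ → Set
  IsQNR n e = Coprime ∣ n ∣ e × ¬ (∃ λ (y : ℤ) → (+ e) ∣ℤ (y ℤ.* y ℤ.- n))

  Subset : Set
  Subset = Carrier → Bool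

  countL : List Carrier → Subset → ℕ
  countL List.[] D = 0
  countL (x List.∷ xs) D = if D x then suc (countL xs D) else countL xs D

  card : Subset → ℕ
  card D = countL elems D

  anyL : List Carrier → (Carrier → Bool) → Bool
  anyL List.[] p = false
  anyL (x List.∷ xs) p = if p x then true else anyL xs p

  image : ℤ → Subset → Subset
  image n D g = anyL elems (λ h → if D h then does ((n · h) ≟ g) else false)

  _∩_ : Subset → Subset → Subset
  (D ∩ E) g = if D g then E g else false

  -- Group ring ℤ[G]: integer-valued functions on G; A(x) = Σ_g A(g) x^g.
  ZG : Set
  ZG = Carrier → ℤ

  _≈_ : ZG → ZG → Set
  A ≈ B = ∀ g → A g ≡ B g

  _+G_ : ZG → ZG → ZG
  (A +G B) g = A g ℤ.+ B g

  _-G_ : ZG → ZG → ZG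
  (A -G B) g = A g ℤ.- B g

  _⋆_ : ℤ → ZG → ZG
  (c ⋆ A) g = c ℤ.* A g

  _*G_ : ZG → ZG → ZG
  (A *G B) g = sumL elems (λ h → A h ℤ.* B (g ⊕ (⊖ h)))

  one : ZG
  one g = if does (g ≟ 0g) then + 1 else + 0

  allG : ZG
  allG g = + 1

  ⟦_⟧ : Subset → ZG
  ⟦ D ⟧ g = if D g then + 1 else + 0

  -- A(x^n) = Σ_h a_h x^{n·h}
  dil : ℤ → ZG → ZG
  dil n A g = sumL elems (λ h → if does ((n · h) ≟ g) then A h else + 0)

  -- Schur ring given by basic quantities B₀ = [1], B₁, …, B_{r-1}:
  -- each B_i is T_i(x) for a nonempty subset T_i (0/1-valued, not zero),
  -- the T_i partition G (Σ B_i = G(x)), B₀ = [1], the set of basic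
  -- elements is closed under x ↦ x^{-1}, and their ℤ-span is closed under
  -- multiplication (so the span is an r-dimensional Schur ring on G).
  IsSchurRing : (r : ℕ) → (Fin (suc r) → ZG) → Set
  IsSchurRing r B =
      (B Fin.zero ≈ one)
    × (∀ i g → (B i g ≡ + 0) ⊎ (B i g ≡ + 1))
    × (∀ i → ∃ λ g → B i g ≡ + 1)
    × ((λ g → sumFin (suc r) (λ i → B i g)) ≈ allG)
    × (∀ i → ∃ λ j → dil (ℤ.- + 1) (B i) ≈ B j)
    × (∀ i j → ∃ λ (c : Fin (suc r) → ℤ) →
         (B i *G B j) ≈ (λ g → sumFin (suc r) (λ l → c l ℤ.* B l g)))

  k₀ : ℤ → Subset → ℕ
  k₀ n₀ D = card (D ∩ image (ℤ.- n₀) D)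

  IsGSHDS : Subset → ℤ → ℤ → Set
  IsGSHDS D n₀ lam =
      (∃ λ e → IsExponent e × IsQNR n₀ e)
    × ((⟦ D ⟧ +G dil n₀ ⟦ D ⟧) ≈ (allG -G one))
    × ((⟦ D ⟧ *G dil n₀ ⟦ D ⟧) ≈ (((+ k₀ n₀ D ℤ.- lam) ⋆ one) +G (lam ⋆ allG)))

  IsPDS : Subset → ℤ → ℤ → ℤ → ℤ → Set
  IsPDS D v k λ' μ =
      (+ order ≡ v)
    × (+ card D ≡ k)
    × (D 0g ≡ false)
    × (∀ g → D (⊖ g) ≡ D g)
    × ((⟦ D ⟧ *G dil (ℤ.- + 1) ⟦ D ⟧)
        ≈ ((k ⋆ one) +G ((λ' ⋆ ⟦ D ⟧) +G (μ ⋆ ((allG -G one) -G ⟦ D ⟧)))))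

  IsSkewHadamardDS : Subset → ℤ → ℤ → ℤ → Set
  IsSkewHadamardDS D v k lam =
      (+ order ≡ v)
    × (+ card D ≡ k)
    × ((⟦ D ⟧ *G dil (ℤ.- + 1) ⟦ D ⟧) ≈ (((k ℤ.- lam) ⋆ one) +G (lam ⋆ allG)))
    × ((⟦ D ⟧ +G dil (ℤ.- + 1) ⟦ D ⟧) ≈ (allG -G one))

basisA : (G : FinAbGroup) → Subset G → ℤ → Fin 3 → ZG G
basisA G D n₀ Fin.zero = one G
basisA G D n₀ (Fin.suc Fin.zero) = ⟦_⟧ G D
basisA G D n₀ (Fin.suc (Fin.suc Fin.zero)) = dil G n₀ (⟦_⟧ G D)

-- Write 𝔻 = D(x), 𝔻′ = D(x^{n₀}) and ‾A = A(x⁻¹).  Multiplying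
-- 𝔻 + 𝔻′ = G − [1] by 𝔻 gives 𝔻² = (k − λ)G − 𝔻 − c[1] with c = k₀ − λ,
-- and likewise for ‾𝔻.  For T = G − [1] − 𝔻 − ‾𝔻 and ε = 𝔻 − ‾𝔻 this
-- yields εT = TG = εG = 0 and T² + ε² = Δ[1] + μG with Δ = 1 − 4c, so
-- T⁴ = ΔT² and ε⁴ = Δε².  For symmetric S the coefficient of x⁰ in S²
-- is Σ S_g² ≥ 0; applied to S = T² and S = ε² (T is symmetric, ε
-- antisymmetric) this gives Δ·Σ T_g² ≥ 0 and −Δ·Σ ε_g² ≥ 0.  As Δ is odd,
-- either ε = 0, so D = D^{(-1)} and k₀ = 0, or T = 0, so
-- D^{(-1)} = D^{(n₀)} and k₀ = k.  The parameters then follow by counting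
-- (v = 2k + 1 and k² = c + λv), and the formulas for 𝔻², 𝔻′² and 𝔻𝔻′
-- show that [1], 𝔻, 𝔻′ span a Schur ring.

module Submission where

open import Defs
open import Data.Bool using (Bool; true; false; if_then_else_)
open import Data.Empty using (⊥-elim)
open import Data.Fin using (Fin)
open import Data.Fin.Patterns using (0F; 1F; 2F)
open import Data.Integer using (ℤ; +_; -[1+_]; _+_; _*_; _-_; -_; _≤_; +≤+; -≤+)
import Data.Integer as ℤ
import Data.Integer.Properties as ℤ
open import Data.Integer.Tactic.RingSolver using (solve-∀)
open import Data.List using (List; []; _∷_; length)
open import Data.List.Membership.Propositional using (_∈_)
open import Data.List.Relation.Unary.All as All using ()
open import Data.List.Relation.Unary.AllPairs using (AllPairs; _∷_)
open import Data.List.Relation.Unary.Any using (here; there)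
open import Data.Maybe using (Maybe; just; nothing)
open import Data.Nat as ℕ using (ℕ; z≤n; s≤s)
import Data.Nat.Divisibility as ℕ
import Data.Nat.Properties as ℕ
open import Data.Product using (∃; _×_; _,_; proj₁; proj₂)
open import Data.Sum using (_⊎_; inj₁; inj₂)
open import Relation.Binary.Definitions using (tri<; tri≈; tri>)
open import Relation.Binary.PropositionalEquality
open import Relation.Nullary using (does; yes; no)
open import Relation.Nullary.Decidable using (dec-true; dec-false)
open import Algebra.Bundles using (AbelianGroup; CommutativeRing)
open import Algebra.Structures using (IsAbelianGroup)
import Algebra.Construct.Pointwise as Pointwise
import Algebra.Properties.AbelianGroup as AbelianGroupProperties
import Algebra.Properties.Group as GroupProperties
import Algebra.Solver.Ring
open import Algebra.Solver.Ring.AlmostCommutativeRing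
  using (fromCommutativeRing; _-Raw-AlmostCommutative⟶_)

module _ {A : Set} where

  sumL-cong : ∀ xs {f g : A → ℤ} → (∀ x → f x ≡ g x) → sumL xs f ≡ sumL xs g
  sumL-cong []       f≗g = refl
  sumL-cong (x ∷ xs) f≗g = cong₂ _+_ (f≗g x) (sumL-cong xs f≗g)

  sumL-+ : ∀ xs (f g : A → ℤ) → sumL xs (λ x → f x + g x) ≡ sumL xs f + sumL xs g
  sumL-+ []       f g = refl
  sumL-+ (x ∷ xs) f g = trans (cong (_+_ (f x + g x)) (sumL-+ xs f g))
                              (interchange (f x) (g x) (sumL xs f) (sumL xs g))
    where
    interchange : ∀ a b c d → a + b + (c + d) ≡ a + c + (b + d)
    interchange = solve-∀

  sumL-*ˡ : ∀ xs c (f : A → ℤ) → sumL xs (λ x → c * f x) ≡ c * sumL xs f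
  sumL-*ˡ []       c f = sym (ℤ.*-zeroʳ c)
  sumL-*ˡ (x ∷ xs) c f = trans (cong (_+_ (c * f x)) (sumL-*ˡ xs c f))
                               (sym (ℤ.*-distribˡ-+ c (f x) (sumL xs f)))

  sumL-*ʳ : ∀ xs (f : A → ℤ) c → sumL xs (λ x → f x * c) ≡ sumL xs f * c
  sumL-*ʳ xs f c = trans (sumL-cong xs (λ x → ℤ.*-comm (f x) c))
                         (trans (sumL-*ˡ xs c f) (ℤ.*-comm c _))

  sumL-neg : ∀ xs (f : A → ℤ) → sumL xs (λ x → - f x) ≡ - sumL xs f
  sumL-neg []       f = refl
  sumL-neg (x ∷ xs) f = trans (cong (_+_ (- f x)) (sumL-neg xs f))
                              (sym (ℤ.neg-distrib-+ (f x) (sumL xs f)))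

  sumL-zero : ∀ xs (f : A → ℤ) → (∀ x → x ∈ xs → f x ≡ + 0) → sumL xs f ≡ + 0
  sumL-zero []       f f≡0 = refl
  sumL-zero (x ∷ xs) f f≡0 =
    cong₂ _+_ (f≡0 x (here refl)) (sumL-zero xs f (λ y y∈xs → f≡0 y (there y∈xs)))

  sumL-nonNeg : ∀ xs (f : A → ℤ) → (∀ x → + 0 ≤ f x) → + 0 ≤ sumL xs f
  sumL-nonNeg []       f 0≤f = ℤ.≤-refl
  sumL-nonNeg (x ∷ xs) f 0≤f = ℤ.+-mono-≤ (0≤f x) (sumL-nonNeg xs f 0≤f)

  term≤sumL : ∀ xs (f : A → ℤ) → (∀ x → + 0 ≤ f x) → ∀ {y} → y ∈ xs → f y ≤ sumL xs f
  term≤sumL (x ∷ xs) f 0≤f (here refl) =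
    subst (_≤ f x + sumL xs f) (ℤ.+-identityʳ (f x))
          (ℤ.+-monoʳ-≤ (f x) (sumL-nonNeg xs f 0≤f))
  term≤sumL (x ∷ xs) f 0≤f (there y∈xs) =
    ℤ.≤-trans (term≤sumL xs f 0≤f y∈xs)
              (subst (_≤ f x + sumL xs f) (ℤ.+-identityˡ _) (ℤ.+-monoˡ-≤ (sumL xs f) (0≤f x)))

  sumL≢0⇒term≢0 : ∀ xs (f : A → ℤ) → sumL xs f ≢ + 0 → ∃ λ x → x ∈ xs × f x ≢ + 0
  sumL≢0⇒term≢0 []       f sum≢0 = ⊥-elim (sum≢0 refl)
  sumL≢0⇒term≢0 (x ∷ xs) f sum≢0 with f x ℤ.≟ + 0
  ... | no  fx≢0 = x , here refl , fx≢0
  ... | yes fx≡0 with sumL≢0⇒term≢0 xs f (λ rest≡0 → sum≢0 (cong₂ _+_ fx≡0 rest≡0))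
  ...   | y , y∈xs , fy≢0 = y , there y∈xs , fy≢0

  sumL-select : ∀ xs → AllPairs _≢_ xs → (P : A → Bool) (f : A → ℤ) {a : A} →
                a ∈ xs → (∀ x → P x ≡ true → x ≡ a) → P a ≡ true →
                sumL xs (λ x → if P x then f x else + 0) ≡ f a
  sumL-select (x ∷ xs) (x∉xs ∷ unique) P f a∈ P⇒a Pa with P x in Px
  ... | true with refl ← P⇒a x Px =
    trans (cong (_+_ (f x)) (sumL-zero xs _ (λ y y∈xs → cong (λ b → if b then f y else + 0)
                                                              (P-false y y∈xs))))
          (ℤ.+-identityʳ (f x))
    where
    P-false : ∀ y → y ∈ xs → P y ≡ false
    P-false y y∈xs with P y in Py
    ... | false = refl
    ... | true  = ⊥-elim (All.lookup x∉xs y∈xs (sym (P⇒a y Py)))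
  sumL-select (x ∷ xs) _ P f (here refl) P⇒a Pa | false with () ← trans (sym Px) Pa
  sumL-select (x ∷ xs) (_ ∷ unique) P f (there a∈xs) P⇒a Pa | false =
    trans (ℤ.+-identityˡ _) (sumL-select xs unique P f a∈xs P⇒a Pa)

sumL-swap : {A B : Set} (xs : List A) (ys : List B) (M : A → B → ℤ) →
            sumL xs (λ a → sumL ys (M a)) ≡ sumL ys (λ b → sumL xs (λ a → M a b))
sumL-swap []       ys M = sym (sumL-zero ys _ (λ _ _ → refl))
sumL-swap (x ∷ xs) ys M = trans (cong (_+_ (sumL ys (M x))) (sumL-swap xs ys M))
                                (sym (sumL-+ ys (M x) (λ b → sumL xs (λ a → M a b))))

0≤i*i : ∀ i → + 0 ≤ i * i
0≤i*i (+ n)    = subst (_≤ + n * + n) (ℤ.*-zeroʳ (+ n)) (ℤ.*-monoˡ-≤-nonNeg (+ n) (+≤+ z≤n))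
0≤i*i -[1+ n ] = subst (_≤ -[1+ n ] * -[1+ n ]) (ℤ.*-zeroʳ -[1+ n ])
                       (ℤ.*-monoˡ-≤-nonPos -[1+ n ] (-≤+ {n} {0}))

i+j≡k⇒i≡k-j : ∀ i j k → i + j ≡ k → i ≡ k - j
i+j≡k⇒i≡k-j i j k i+j≡k = trans (i≡[i+j]-j i j) (cong (_- j) i+j≡k)
  where
  i≡[i+j]-j : ∀ i j → i ≡ (i + j) - j
  i≡[i+j]-j = solve-∀

i-j≡k⇒i≡k+j : ∀ i j k → i - j ≡ k → i ≡ k + j
i-j≡k⇒i≡k+j i j k i-j≡k = trans (i≡[i-j]+j i j) (cong (_+ j) i-j≡k)
  where
  i≡[i-j]+j : ∀ i j → i ≡ (i - j) + j
  i≡[i-j]+j = solve-∀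

0<i⇒0≤i*j⇒0≤j : ∀ {i j} → + 0 ℤ.< i → + 0 ≤ i * j → + 0 ≤ j
0<i⇒0≤i*j⇒0≤j {i} {j} 0<i 0≤ij =
  ℤ.*-cancelˡ-≤-pos (+ 0) j i {{ℤ.positive 0<i}} (subst (_≤ i * j) (sym (ℤ.*-zeroʳ i)) 0≤ij)

i<0⇒0≤i*j⇒j≤0 : ∀ {i j} → i ℤ.< + 0 → + 0 ≤ i * j → j ≤ + 0
i<0⇒0≤i*j⇒j≤0 {i} {j} i<0 0≤ij =
  ℤ.*-cancelˡ-≤-neg i (+ 0) j {{ℤ.negative i<0}} (subst (_≤ i * j) (sym (ℤ.*-zeroʳ i)) 0≤ij)

1-4i≢0 : ∀ i → + 1 - + 4 * i ≢ + 0
1-4i≢0 i eq with ℕ.m*n≡1⇒m≡1 4 ℤ.∣ i ∣ (trans (sym (ℤ.abs-* (+ 4) i)) (cong ℤ.∣_∣ 4i≡1))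
  where
  4i≡1 : + 4 * i ≡ + 1
  4i≡1 = sym (ℤ.i-j≡0⇒i≡j (+ 1) (+ 4 * i) eq)
... | ()

-- The group ring ℤ[G]

module GroupRing (G : FinAbGroup) where
  open FinAbGroup G public
  open IsAbelianGroup isAbelianGroup using (assoc; comm; identityˡ; identityʳ; inverseʳ)

  private
    abelianGroup : AbelianGroup _ _
    abelianGroup = record { isAbelianGroup = isAbelianGroup }
  open AbelianGroupProperties abelianGroup using (⁻¹-∙-comm)
  open GroupProperties (AbelianGroup.group abelianGroup) public
    using () renaming (⁻¹-involutive to ⊖-involutive; ε⁻¹≈ε to ⊖0g≡0g)

  infixl 6 _─_
  _─_ : Carrier → Carrier → Carrier
  x ─ y = x ⊕ (⊖ y)

  ⊖-distrib-⊕ : ∀ x y → ⊖ (x ⊕ y) ≡ (⊖ x) ⊕ (⊖ y)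
  ⊖-distrib-⊕ x y = sym (⁻¹-∙-comm x y)

  x─[x─y]≡y : ∀ x y → x ─ (x ─ y) ≡ y
  x─[x─y]≡y x y = begin
    x ⊕ (⊖ (x ⊕ (⊖ y)))      ≡⟨ cong (x ⊕_) (⊖-distrib-⊕ x (⊖ y)) ⟩
    x ⊕ ((⊖ x) ⊕ (⊖ (⊖ y)))  ≡⟨ assoc x (⊖ x) _ ⟨
    (x ⊕ (⊖ x)) ⊕ (⊖ (⊖ y))  ≡⟨ cong₂ _⊕_ (inverseʳ x) (⊖-involutive y) ⟩
    0g ⊕ y                   ≡⟨ identityˡ y ⟩
    y                        ∎
    where open ≡-Reasoning

  [x⊕y]─x≡y : ∀ x y → (x ⊕ y) ─ x ≡ y
  [x⊕y]─x≡y x y = begin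
    (x ⊕ y) ⊕ (⊖ x)  ≡⟨ cong (_⊕ (⊖ x)) (comm x y) ⟩
    (y ⊕ x) ⊕ (⊖ x)  ≡⟨ assoc y x (⊖ x) ⟩
    y ⊕ (x ⊕ (⊖ x))  ≡⟨ cong (y ⊕_) (inverseʳ x) ⟩
    y ⊕ 0g           ≡⟨ identityʳ y ⟩
    y                ∎
    where open ≡-Reasoning

  x⊕[y─x]≡y : ∀ x y → x ⊕ (y ─ x) ≡ y
  x⊕[y─x]≡y x y = begin
    x ⊕ (y ⊕ (⊖ x))  ≡⟨ cong (x ⊕_) (comm y (⊖ x)) ⟩
    x ⊕ ((⊖ x) ⊕ y)  ≡⟨ assoc x (⊖ x) y ⟨
    (x ⊕ (⊖ x)) ⊕ y  ≡⟨ cong (_⊕ y) (inverseʳ x) ⟩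
    0g ⊕ y           ≡⟨ identityˡ y ⟩
    y                ∎
    where open ≡-Reasoning

  x─[y⊕z]≡x─y─z : ∀ x y z → x ─ (y ⊕ z) ≡ x ─ y ─ z
  x─[y⊕z]≡x─y─z x y z = trans (cong (x ⊕_) (⊖-distrib-⊕ y z)) (sym (assoc x (⊖ y) (⊖ z)))

  x─0g≡x : ∀ x → x ─ 0g ≡ x
  x─0g≡x x = trans (cong (x ⊕_) ⊖0g≡0g) (identityʳ x)

  ⊖x─⊖y≡⊖[x─y] : ∀ x y → ⊖ x ─ ⊖ y ≡ ⊖ (x ─ y)
  ⊖x─⊖y≡⊖[x─y] x y = sym (⊖-distrib-⊕ x (⊖ y))

  ≟-true⇒≡ : ∀ {x y} → does (x ≟ y) ≡ true → x ≡ y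
  ≟-true⇒≡ {x} {y} eq with x ≟ y
  ... | yes x≡y = x≡y

  ∑ : (Carrier → ℤ) → ℤ
  ∑ f = sumL elems f

  ∑-select : (P : Carrier → Bool) (f : Carrier → ℤ) (a : Carrier) →
             (∀ x → P x ≡ true → x ≡ a) → P a ≡ true →
             ∑ (λ x → if P x then f x else + 0) ≡ f a
  ∑-select P f a = sumL-select elems elems-unique P f (elems-complete a)

  ∑-reindex : (σ σ⁻¹ : Carrier → Carrier) → (∀ x → σ⁻¹ (σ x) ≡ x) → (∀ y → σ (σ⁻¹ y) ≡ y) →
              (A : Carrier → ℤ) → ∑ (λ x → A (σ x)) ≡ ∑ A
  ∑-reindex σ σ⁻¹ left right A = sym (begin
    ∑ A
      ≡⟨ sumL-cong elems (λ y → sym (∑-select (λ x → does (σ x ≟ y)) (λ _ → A y) (σ⁻¹ y)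
                                   (λ x σx≡y → trans (sym (left x)) (cong σ⁻¹ (≟-true⇒≡ σx≡y)))
                                   (dec-true (σ (σ⁻¹ y) ≟ y) (right y)))) ⟩
    ∑ (λ y → ∑ (λ x → if does (σ x ≟ y) then A y else + 0))
      ≡⟨ sumL-swap elems elems _ ⟩
    ∑ (λ x → ∑ (λ y → if does (σ x ≟ y) then A y else + 0))
      ≡⟨ sumL-cong elems (λ x → ∑-select (λ y → does (σ x ≟ y)) A (σ x)
                                  (λ y σx≡y → sym (≟-true⇒≡ σx≡y)) (dec-true (σ x ≟ σ x) refl)) ⟩
    ∑ (λ x → A (σ x))
      ∎)
    where open ≡-Reasoning

  ∑-translate : ∀ (A : Carrier → ℤ) h → ∑ (λ g → A (g ─ h)) ≡ ∑ A
  ∑-translate A h = ∑-reindex (_─ h) (_⊕ h) (λ x → trans (comm _ h) (x⊕[y─x]≡y h x))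
                              (λ y → trans (cong (_─ h) (comm y h)) ([x⊕y]─x≡y h y)) A

  ∑-⊖ : ∀ (A : Carrier → ℤ) → ∑ (λ g → A (⊖ g)) ≡ ∑ A
  ∑-⊖ = ∑-reindex ⊖_ ⊖_ ⊖-involutive ⊖-involutive

  R : Set
  R = ZG G

  infix  4 _≋_
  infixl 6 _⊞_ _⊟_
  infixl 7 _⊛_ _•_

  _≋_ : R → R → Set
  _≋_ = _≈_ G

  _⊞_ _⊟_ _⊛_ : R → R → R
  _⊞_ = _+G_ G
  _⊟_ = _-G_ G
  _⊛_ = _*G_ G

  _•_ : ℤ → R → R
  _•_ = _⋆_ G

  𝟘 𝟙 𝔾 : R
  𝟘 _ = + 0
  𝟙 = one G
  𝔾 = allG G

  𝟙-0g : 𝟙 0g ≡ + 1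
  𝟙-0g = cong (λ b → if b then + 1 else + 0) (dec-true (0g ≟ 0g) refl)

  𝟙-≢0g : ∀ {g} → g ≢ 0g → 𝟙 g ≡ + 0
  𝟙-≢0g g≢0g = cong (λ b → if b then + 1 else + 0) (dec-false (_ ≟ 0g) g≢0g)

  ⊛-comm : ∀ A B → A ⊛ B ≋ B ⊛ A
  ⊛-comm A B g = begin
    ∑ (λ h → A h * B (g ─ h))
      ≡⟨ ∑-reindex (g ─_) (g ─_) (x─[x─y]≡y g) (x─[x─y]≡y g) _ ⟨
    ∑ (λ h → A (g ─ h) * B (g ─ (g ─ h)))
      ≡⟨ sumL-cong elems (λ h → trans (cong (λ x → A (g ─ h) * B x) (x─[x─y]≡y g h))
                                      (ℤ.*-comm (A (g ─ h)) (B h))) ⟩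
    ∑ (λ h → B h * A (g ─ h))
      ∎
    where open ≡-Reasoning

  ⊛-assoc : ∀ A B C → (A ⊛ B) ⊛ C ≋ A ⊛ (B ⊛ C)
  ⊛-assoc A B C g = begin
    ∑ (λ h → ∑ (λ k → A k * B (h ─ k)) * C (g ─ h))
      ≡⟨ sumL-cong elems (λ h → sym (sumL-*ʳ elems _ _)) ⟩
    ∑ (λ h → ∑ (λ k → A k * B (h ─ k) * C (g ─ h)))
      ≡⟨ sumL-swap elems elems _ ⟩
    ∑ (λ k → ∑ (λ h → A k * B (h ─ k) * C (g ─ h)))
      ≡⟨ sumL-cong elems (λ k → trans (sumL-cong elems (λ h → ℤ.*-assoc (A k) _ _))
                                      (sumL-*ˡ elems (A k) _)) ⟩
    ∑ (λ k → A k * ∑ (λ h → B (h ─ k) * C (g ─ h)))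
      ≡⟨ sumL-cong elems (λ k → cong (A k *_) (translate k)) ⟩
    ∑ (λ k → A k * ∑ (λ j → B j * C (g ─ k ─ j)))
      ∎
    where
    open ≡-Reasoning
    translate : ∀ k → ∑ (λ h → B (h ─ k) * C (g ─ h)) ≡ ∑ (λ j → B j * C (g ─ k ─ j))
    translate k = trans (sym (∑-reindex (k ⊕_) (_─ k) ([x⊕y]─x≡y k) (x⊕[y─x]≡y k) _))
      (sumL-cong elems (λ j → cong₂ (λ u w → B u * C w) ([x⊕y]─x≡y k j) (x─[y⊕z]≡x─y─z g k j)))

  ⊛-congˡ : ∀ {A A'} B → A ≋ A' → A ⊛ B ≋ A' ⊛ B
  ⊛-congˡ B A≋A' g = sumL-cong elems (λ h → cong (_* B (g ─ h)) (A≋A' h))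

  ⊛-congʳ : ∀ A {B B'} → B ≋ B' → A ⊛ B ≋ A ⊛ B'
  ⊛-congʳ A B≋B' g = sumL-cong elems (λ h → cong (A h *_) (B≋B' (g ─ h)))

  ⊛-distribˡ : ∀ A B C → A ⊛ (B ⊞ C) ≋ A ⊛ B ⊞ A ⊛ C
  ⊛-distribˡ A B C g =
    trans (sumL-cong elems (λ h → ℤ.*-distribˡ-+ (A h) (B (g ─ h)) (C (g ─ h)))) (sumL-+ elems _ _)

  ⊛-distribʳ : ∀ A B C → (B ⊞ C) ⊛ A ≋ B ⊛ A ⊞ C ⊛ A
  ⊛-distribʳ A B C g =
    trans (sumL-cong elems (λ h → ℤ.*-distribʳ-+ (A (g ─ h)) (B h) (C h))) (sumL-+ elems _ _)

  ⊛-identityˡ : ∀ A → 𝟙 ⊛ A ≋ A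
  ⊛-identityˡ A g = begin
    ∑ (λ h → 𝟙 h * A (g ─ h))
      ≡⟨ sumL-cong elems (λ h → indicator-* (does (h ≟ 0g)) (A (g ─ h))) ⟩
    ∑ (λ h → if does (h ≟ 0g) then A (g ─ h) else + 0)
      ≡⟨ ∑-select (λ h → does (h ≟ 0g)) (λ h → A (g ─ h)) 0g (λ _ → ≟-true⇒≡) (dec-true (0g ≟ 0g) refl) ⟩
    A (g ─ 0g)
      ≡⟨ cong A (x─0g≡x g) ⟩
    A g
      ∎
    where
    open ≡-Reasoning
    indicator-* : ∀ b y → (if b then + 1 else + 0) * y ≡ (if b then y else + 0)
    indicator-* true  y = ℤ.*-identityˡ y
    indicator-* false y = refl

  ⊛-identityʳ : ∀ A → A ⊛ 𝟙 ≋ A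
  ⊛-identityʳ A g = trans (⊛-comm A 𝟙 g) (⊛-identityˡ A g)

  •-⊛ : ∀ c A B → (c • A) ⊛ B ≋ c • (A ⊛ B)
  •-⊛ c A B g = trans (sumL-cong elems (λ h → ℤ.*-assoc c (A h) (B (g ─ h)))) (sumL-*ˡ elems c _)

  groupRing : CommutativeRing _ _
  groupRing = record
    { Carrier = R ; _≈_ = _≋_ ; _+_ = _⊞_ ; _*_ = _⊛_ ; -_ = λ A g → - A g ; 0# = 𝟘 ; 1# = 𝟙
    ; isCommutativeRing = record
      { isRing = record
        { +-isAbelianGroup = Pointwise.isAbelianGroup Carrier ℤ.+-0-isAbelianGroup
        ; *-cong = λ {A} {A'} {B} e₁ e₂ g → trans (⊛-congˡ B e₁ g) (⊛-congʳ A' e₂ g)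
        ; *-assoc = ⊛-assoc
        ; *-identity = ⊛-identityˡ , ⊛-identityʳ
        ; distrib = ⊛-distribˡ , ⊛-distribʳ
        }
      ; *-comm = ⊛-comm
      }
    }

  ι : ℤ → R
  ι a = a • 𝟙

  ι-⊛ : ∀ a A → ι a ⊛ A ≋ a • A
  ι-⊛ a A g = trans (•-⊛ a 𝟙 A g) (cong (a *_) (⊛-identityˡ A g))

  private
    ι-homomorphism : ℤ.+-*-rawRing -Raw-AlmostCommutative⟶ fromCommutativeRing groupRing
    ι-homomorphism = record
      { ⟦_⟧    = ι
      ; +-homo = λ a b g → ℤ.*-distribʳ-+ (𝟙 g) a b
      ; *-homo = λ a b g → sym (trans (ι-⊛ a (ι b) g) (sym (ℤ.*-assoc a b (𝟙 g))))
      ; -‿homo = λ a g → sym (ℤ.neg-distribˡ-* a (𝟙 g))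
      ; 0-homo = λ g → ℤ.*-zeroˡ (𝟙 g)
      ; 1-homo = λ g → ℤ.*-identityˡ (𝟙 g)
      }

    ι-equal? : ∀ a b → Maybe (ι a ≋ ι b)
    ι-equal? a b with a ℤ.≟ b
    ... | yes refl = just (λ _ → refl)
    ... | no  _    = nothing

  open Algebra.Solver.Ring ℤ.+-*-rawRing (fromCommutativeRing groupRing) ι-homomorphism ι-equal? public
    using (solve; _:=_; con; _:+_; _:*_; _:-_)

  ∑-⊛ : ∀ A B → ∑ (A ⊛ B) ≡ ∑ A * ∑ B
  ∑-⊛ A B = begin
    ∑ (λ g → ∑ (λ h → A h * B (g ─ h)))  ≡⟨ sumL-swap elems elems _ ⟩
    ∑ (λ h → ∑ (λ g → A h * B (g ─ h)))  ≡⟨ sumL-cong elems (λ h → sumL-*ˡ elems (A h) _) ⟩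
    ∑ (λ h → A h * ∑ (λ g → B (g ─ h)))  ≡⟨ sumL-cong elems (λ h → cong (A h *_) (∑-translate B h)) ⟩
    ∑ (λ h → A h * ∑ B)                  ≡⟨ sumL-*ʳ elems A (∑ B) ⟩
    ∑ A * ∑ B                            ∎
    where open ≡-Reasoning

  ⊛-𝔾 : ∀ A g → (A ⊛ 𝔾) g ≡ ∑ A
  ⊛-𝔾 A g = sumL-cong elems (λ h → ℤ.*-identityʳ (A h))

  ∑-𝟙 : ∑ 𝟙 ≡ + 1
  ∑-𝟙 = ∑-select (λ h → does (h ≟ 0g)) (λ _ → + 1) 0g (λ _ → ≟-true⇒≡) (dec-true (0g ≟ 0g) refl)

  ∑-ι : ∀ a → ∑ (ι a) ≡ a
  ∑-ι a = trans (sumL-*ˡ elems a 𝟙) (trans (cong (a *_) ∑-𝟙) (ℤ.*-identityʳ a))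

  ∑-𝔾 : ∑ 𝔾 ≡ + order G
  ∑-𝔾 = ∑-const1 elems
    where
    ∑-const1 : ∀ xs → sumL xs (λ _ → + 1) ≡ + length xs
    ∑-const1 []       = refl
    ∑-const1 (x ∷ xs) = cong (_+_ (+ 1)) (∑-const1 xs)

  ∑-⊟ : ∀ A B → ∑ (A ⊟ B) ≡ ∑ A - ∑ B
  ∑-⊟ A B = trans (sumL-+ elems A (λ g → - B g)) (cong (_+_ (∑ A)) (sumL-neg elems B))

  ‾_ : R → R
  (‾ A) g = A (⊖ g)

  ‾-⊛ : ∀ A B → ‾ (A ⊛ B) ≋ ‾ A ⊛ ‾ B
  ‾-⊛ A B g = trans (sym (∑-⊖ _))
    (sumL-cong elems (λ h → cong (λ x → A (⊖ h) * B x) (⊖x─⊖y≡⊖[x─y] g h)))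

  ‾𝟙 : ‾ 𝟙 ≋ 𝟙
  ‾𝟙 g with g ≟ 0g
  ... | yes refl = trans (cong 𝟙 ⊖0g≡0g) 𝟙-0g
  ... | no  g≢0g = 𝟙-≢0g (λ ⊖g≡0g → g≢0g (trans (sym (⊖-involutive g))
                                            (trans (cong ⊖_ ⊖g≡0g) ⊖0g≡0g)))

  ·-neg : ∀ n x → _·_ G (- n) x ≡ ⊖ (_·_ G n x)
  ·-neg (+ 0)      x = sym ⊖0g≡0g
  ·-neg (+ ℕ.suc m) x = refl
  ·-neg -[1+ m ]   x = sym (⊖-involutive _)

  dil-neg : ∀ A → dil G (- + 1) A ≋ ‾ A
  dil-neg A g = ∑-select _ A (⊖ g)
    (λ h -h≡g → trans (sym (identityʳ h)) (trans (sym (⊖-involutive _)) (cong ⊖_ (≟-true⇒≡ -h≡g))))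
    (dec-true (_ ≟ g) (trans (cong ⊖_ (identityʳ (⊖ g))) (⊖-involutive g)))

  sumSq : R → ℤ
  sumSq A = ∑ (λ h → A h * A h)

  0≤sumSq : ∀ A → + 0 ≤ sumSq A
  0≤sumSq A = sumL-nonNeg elems _ (λ h → 0≤i*i (A h))

  sumSq≡0⇒≋𝟘 : ∀ A → sumSq A ≡ + 0 → A ≋ 𝟘
  sumSq≡0⇒≋𝟘 A sumSq≡0 h with ℤ.i*j≡0⇒i≡0∨j≡0 (A h) (ℤ.≤-antisym square≤0 (0≤i*i (A h)))
    where
    square≤0 : A h * A h ≤ + 0
    square≤0 = subst (A h * A h ≤_) sumSq≡0
                     (term≤sumL elems _ (λ x → 0≤i*i (A x)) (elems-complete h))
  ... | inj₁ Ah≡0 = Ah≡0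
  ... | inj₂ Ah≡0 = Ah≡0

  ⊛-0g : ∀ A B → (A ⊛ B) 0g ≡ ∑ (λ h → A h * B (⊖ h))
  ⊛-0g A B = sumL-cong elems (λ h → cong (λ x → A h * B x) (identityˡ (⊖ h)))

  ⊛‾-0g : ∀ A → (A ⊛ ‾ A) 0g ≡ sumSq A
  ⊛‾-0g A = trans (⊛-0g A (‾ A)) (sumL-cong elems (λ h → cong (λ x → A h * A x) (⊖-involutive h)))

  0≤Δ*S0g : ∀ Δ {S} → ‾ S ≋ S → S ⊛ S ≋ Δ • S → + 0 ≤ Δ * S 0g
  0≤Δ*S0g Δ {S} ‾S≋S S²≋ΔS = subst (+ 0 ≤_) S²0g≡sumSq (0≤sumSq S)
    where
    S²0g≡sumSq : sumSq S ≡ Δ * S 0g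
    S²0g≡sumSq = trans (sym (⊛‾-0g S)) (trans (⊛-congʳ S ‾S≋S 0g) (S²≋ΔS 0g))

  -- Identities below are derived as linear combinations of hypotheses
  -- A ≋ B, each turned into A ⊟ B ≋ 𝟘: the ring solver checks the
  -- combination, and every summand vanishes.
  ≋⇒⊟≋𝟘 : ∀ {A B} → A ≋ B → A ⊟ B ≋ 𝟘
  ≋⇒⊟≋𝟘 A≋B g = ℤ.i≡j⇒i-j≡0 (A≋B g)

  ⊟≋𝟘⇒≋ : ∀ {A B} → A ⊟ B ≋ 𝟘 → A ≋ B
  ⊟≋𝟘⇒≋ {A} {B} A-B≋𝟘 g = ℤ.i-j≡0⇒i≡j (A g) (B g) (A-B≋𝟘 g)

  𝟘-⊞ : ∀ {A B} → A ≋ 𝟘 → B ≋ 𝟘 → A ⊞ B ≋ 𝟘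
  𝟘-⊞ A≋𝟘 B≋𝟘 g = cong₂ _+_ (A≋𝟘 g) (B≋𝟘 g)

  𝟘-⊟ : ∀ {A B} → A ≋ 𝟘 → B ≋ 𝟘 → A ⊟ B ≋ 𝟘
  𝟘-⊟ A≋𝟘 B≋𝟘 g = cong₂ _-_ (A≋𝟘 g) (B≋𝟘 g)

  𝟘-⊛ : ∀ C {A} → A ≋ 𝟘 → C ⊛ A ≋ 𝟘
  𝟘-⊛ C A≋𝟘 g = sumL-zero elems _ (λ h _ → trans (cong (C h *_) (A≋𝟘 (g ─ h))) (ℤ.*-zeroʳ (C h)))

  ≋𝟘-by : ∀ {A B} → A ≋ B → B ≋ 𝟘 → A ≋ 𝟘
  ≋𝟘-by A≋B B≋𝟘 g = trans (A≋B g) (B≋𝟘 g)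

  module FourthPowers (T ε Δ μ : R) (εT≋𝟘 : ε ⊛ T ≋ 𝟘) (T𝔾≋𝟘 : T ⊛ 𝔾 ≋ 𝟘) (ε𝔾≋𝟘 : ε ⊛ 𝔾 ≋ 𝟘)
                     (T²+ε²≋Δ+μ𝔾 : T ⊛ T ⊞ ε ⊛ ε ≋ Δ ⊞ μ ⊛ 𝔾) where

    T⁴≋ΔT² : (T ⊛ T) ⊛ (T ⊛ T) ≋ Δ ⊛ (T ⊛ T)
    T⁴≋ΔT² = ⊟≋𝟘⇒≋ (≋𝟘-by
      (solve 5 (λ t e g d m →
          (t :* t) :* (t :* t) :- d :* (t :* t)
        := (t :* t) :* ((t :* t :+ e :* e) :- (d :+ m :* g)) :- (e :* t) :* (e :* t) :+ (m :* t) :* (t :* g))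
        (λ _ → refl) T ε 𝔾 Δ μ)
      (𝟘-⊞ (𝟘-⊟ (𝟘-⊛ (T ⊛ T) (≋⇒⊟≋𝟘 T²+ε²≋Δ+μ𝔾)) (𝟘-⊛ (ε ⊛ T) εT≋𝟘)) (𝟘-⊛ (μ ⊛ T) T𝔾≋𝟘)))

    ε⁴≋Δε² : (ε ⊛ ε) ⊛ (ε ⊛ ε) ≋ Δ ⊛ (ε ⊛ ε)
    ε⁴≋Δε² = ⊟≋𝟘⇒≋ (≋𝟘-by
      (solve 5 (λ t e g d m →
          (e :* e) :* (e :* e) :- d :* (e :* e)
        := (e :* e) :* ((t :* t :+ e :* e) :- (d :+ m :* g)) :- (e :* t) :* (e :* t) :+ (m :* e) :* (e :* g))
        (λ _ → refl) T ε 𝔾 Δ μ)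
      (𝟘-⊞ (𝟘-⊟ (𝟘-⊛ (ε ⊛ ε) (≋⇒⊟≋𝟘 T²+ε²≋Δ+μ𝔾)) (𝟘-⊛ (ε ⊛ T) εT≋𝟘)) (𝟘-⊛ (μ ⊛ ε) ε𝔾≋𝟘)))

  ⊛-self-of-complement : ∀ {X Y} c lam → X ⊞ Y ≋ 𝔾 ⊟ 𝟙 → X ⊛ Y ≋ c • 𝟙 ⊞ lam • 𝔾 →
                         ∀ g → (X ⊛ X) g ≡ ∑ X - lam - X g - c * 𝟙 g
  ⊛-self-of-complement {X} {Y} c lam X+Y≋𝔾-𝟙 XY≋c+lam𝔾 g = begin
    ∑ (λ h → X h * X (g ─ h))
      ≡⟨ sumL-cong elems (λ h → cong (X h *_) (i+j≡k⇒i≡k-j _ _ _ (X+Y≋𝔾-𝟙 (g ─ h)))) ⟩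
    ∑ (λ h → X h * (+ 1 - 𝟙 (g ─ h) - Y (g ─ h)))
      ≡⟨ sumL-cong elems (λ h → expand (X h) _ _) ⟩
    ∑ (λ h → X h - X h * 𝟙 (g ─ h) - X h * Y (g ─ h))
      ≡⟨ trans (∑-⊟ _ _) (cong (_- (X ⊛ Y) g) (∑-⊟ X _)) ⟩
    ∑ X - (X ⊛ 𝟙) g - (X ⊛ Y) g
      ≡⟨ cong₂ (λ a b → ∑ X - a - b) (⊛-identityʳ X g) (XY≋c+lam𝔾 g) ⟩
    ∑ X - X g - (c * 𝟙 g + lam * + 1)
      ≡⟨ rearrange (∑ X) (X g) c (𝟙 g) lam ⟩
    ∑ X - lam - X g - c * 𝟙 g
      ∎
    where
    open ≡-Reasoning
    expand : ∀ x o y → x * (+ 1 - o - y) ≡ x - x * o - x * y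
    expand = solve-∀
    rearrange : ∀ s x c o l → s - x - (c * o + l * + 1) ≡ s - l - x - c * o
    rearrange = solve-∀

  ∃-unit-of-∑≢0 : ∀ {A} → (∀ g → A g ≡ + 0 ⊎ A g ≡ + 1) → ∑ A ≢ + 0 → ∃ λ g → A g ≡ + 1
  ∃-unit-of-∑≢0 {A} A∈01 ∑A≢0 with sumL≢0⇒term≢0 elems A ∑A≢0
  ... | g , _ , Ag≢0 with A∈01 g
  ...   | inj₁ Ag≡0 = ⊥-elim (Ag≢0 Ag≡0)
  ...   | inj₂ Ag≡1 = g , Ag≡1

  ⟪_⟫ : Subset G → R
  ⟪_⟫ = ⟦_⟧ G

  ⟪⟫-01 : ∀ S g → ⟪ S ⟫ g ≡ + 0 ⊎ ⟪ S ⟫ g ≡ + 1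
  ⟪⟫-01 S g with S g
  ... | true  = inj₂ refl
  ... | false = inj₁ refl

  0≤⟪⟫ : ∀ S g → + 0 ≤ ⟪ S ⟫ g
  0≤⟪⟫ S g with S g
  ... | true  = +≤+ z≤n
  ... | false = +≤+ z≤n

  indicator-injective : ∀ {a b} → (if a then + 1 else + 0) ≡ (if b then + 1 else + 0) → a ≡ b
  indicator-injective {true}  {true}  _ = refl
  indicator-injective {false} {false} _ = refl

  ∑⟪⟫ : ∀ S → ∑ ⟪ S ⟫ ≡ + card G S
  ∑⟪⟫ S = ∑-count elems
    where
    ∑-count : ∀ xs → sumL xs ⟪ S ⟫ ≡ + countL G xs S
    ∑-count []       = refl
    ∑-count (x ∷ xs) with S x
    ... | true  = cong (_+_ (+ 1)) (∑-count xs)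
    ... | false = trans (ℤ.+-identityˡ _) (∑-count xs)

  card-cong : ∀ {S S'} → (∀ g → S g ≡ S' g) → card G S ≡ card G S'
  card-cong {S} {S'} S≗S' = count-cong elems
    where
    count-cong : ∀ xs → countL G xs S ≡ countL G xs S'
    count-cong []       = refl
    count-cong (x ∷ xs) rewrite S≗S' x = cong (λ n → if S' x then ℕ.suc n else n) (count-cong xs)

  card-∅ : ∀ {S} → (∀ g → S g ≡ false) → card G S ≡ 0
  card-∅ {S} S≗∅ = count-∅ elems
    where
    count-∅ : ∀ xs → countL G xs S ≡ 0
    count-∅ []       = refl
    count-∅ (x ∷ xs) rewrite S≗∅ x = count-∅ xs

  ∑-dil : ∀ n A → ∑ (dil G n A) ≡ ∑ A
  ∑-dil n A = trans (sumL-swap elems elems _)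
    (sumL-cong elems (λ h → ∑-select (λ g → does (_·_ G n h ≟ g)) (λ _ → A h) (_·_ G n h)
                                     (λ g nh≡g → sym (≟-true⇒≡ nh≡g)) (dec-true (_ ≟ _) refl)))

  0≤dil : ∀ n A → (∀ g → + 0 ≤ A g) → ∀ g → + 0 ≤ dil G n A g
  0≤dil n A 0≤A g = sumL-nonNeg elems _ term-nonNeg
    where
    term-nonNeg : ∀ h → + 0 ≤ (if does (_·_ G n h ≟ g) then A h else + 0)
    term-nonNeg h with does (_·_ G n h ≟ g)
    ... | true  = 0≤A h
    ... | false = ℤ.≤-refl

  anyL-witness : ∀ {p} xs → anyL G xs p ≡ true → ∃ λ x → p x ≡ true
  anyL-witness {p} (x ∷ xs) any≡true with p x in px
  ... | true  = x , px
  ... | false = anyL-witness xs any≡true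

  anyL-hit : ∀ {p x} xs → x ∈ xs → p x ≡ true → anyL G xs p ≡ true
  anyL-hit {p} (y ∷ xs) (here refl)  px rewrite px = refl
  anyL-hit {p} (y ∷ xs) (there x∈xs) px with p y
  ... | true  = refl
  ... | false = anyL-hit xs x∈xs px

  image-neg⇒1≤dil : ∀ n S g → image G (- n) S g ≡ true → + 1 ≤ dil G n ⟪ S ⟫ (⊖ g)
  image-neg⇒1≤dil n S g g∈ with anyL-witness elems g∈
  ... | h , hit with S h in Sh
  ...   | true = subst (_≤ dil G n ⟪ S ⟫ (⊖ g)) term≡1
                       (term≤sumL elems _ (λ x → term-nonNeg x) (elems-complete h))
    where
    term-nonNeg : ∀ x → + 0 ≤ (if does (_·_ G n x ≟ (⊖ g)) then ⟪ S ⟫ x else + 0)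
    term-nonNeg x with does (_·_ G n x ≟ (⊖ g))
    ... | true  = 0≤⟪⟫ S x
    ... | false = ℤ.≤-refl
    nh≡⊖g : _·_ G n h ≡ ⊖ g
    nh≡⊖g = trans (sym (⊖-involutive _)) (cong ⊖_ (trans (sym (·-neg n h)) (≟-true⇒≡ hit)))
    term≡1 : (if does (_·_ G n h ≟ (⊖ g)) then ⟪ S ⟫ h else + 0) ≡ + 1
    term≡1 = trans (cong (λ b → if b then ⟪ S ⟫ h else + 0) (dec-true (_ ≟ _) nh≡⊖g))
                   (cong (λ b → if b then + 1 else + 0) Sh)

  dil≢0⇒image-neg : ∀ n S g → dil G n ⟪ S ⟫ (⊖ g) ≢ + 0 → image G (- n) S g ≡ true
  dil≢0⇒image-neg n S g dil≢0 with sumL≢0⇒term≢0 elems _ dil≢0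
  ... | h , _ , term≢0 with _·_ G n h ≟ (⊖ g) | S h in Sh
  ...   | no  _       | _     = ⊥-elim (term≢0 refl)
  ...   | yes _       | false = ⊥-elim (term≢0 refl)
  ...   | yes nh≡⊖g   | true  = anyL-hit elems (elems-complete h) hit
    where
    hit : (if S h then does (_·_ G (- n) h ≟ g) else false) ≡ true
    hit rewrite Sh = dec-true (_ ≟ g) (trans (·-neg n h) (trans (cong ⊖_ nh≡⊖g) (⊖-involutive g)))

-- Generalized skew Hadamard difference sets

module GSHDS (G : FinAbGroup) (D : Subset G) (n₀ lam : ℤ) (gshds : IsGSHDS G D n₀ lam) where
  open GroupRing G

  𝔻 𝔻′ : R
  𝔻  = ⟪ D ⟫
  𝔻′ = dil G n₀ 𝔻

  k v κ₀ : ℕ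
  k  = card G D
  v  = order G
  κ₀ = k₀ G n₀ D

  c : ℤ
  c = + κ₀ - lam

  𝔻+𝔻′ : 𝔻 ⊞ 𝔻′ ≋ 𝔾 ⊟ 𝟙
  𝔻+𝔻′ = proj₁ (proj₂ gshds)

  𝔻𝔻′ : 𝔻 ⊛ 𝔻′ ≋ c • 𝟙 ⊞ lam • 𝔾
  𝔻𝔻′ = proj₂ (proj₂ gshds)

  𝔻′-complement : ∀ g → 𝔻′ g ≡ + 1 - 𝟙 g - 𝔻 g
  𝔻′-complement g = i+j≡k⇒i≡k-j (𝔻′ g) (𝔻 g) _ (trans (ℤ.+-comm (𝔻′ g) (𝔻 g)) (𝔻+𝔻′ g))

  0g∉D : D 0g ≡ false
  0g∉D with D 0g in D0g
  ... | false = refl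
  ... | true  = ⊥-elim (1+i≢0 (0≤dil n₀ 𝔻 (0≤⟪⟫ D) 0g)
                          (trans (cong (λ b → (if b then + 1 else + 0) + 𝔻′ 0g) (sym D0g))
                                 (trans (𝔻+𝔻′ 0g) (cong (_-_ (+ 1)) 𝟙-0g))))
    where
    1+i≢0 : ∀ {i} → + 0 ≤ i → + 1 + i ≢ + 0
    1+i≢0 {+ n} _ ()

  𝔻′-01 : ∀ g → 𝔻′ g ≡ + 0 ⊎ 𝔻′ g ≡ + 1
  𝔻′-01 g with g ≟ 0g | ⟪⟫-01 D g
  ... | yes refl | _ = inj₁ (trans (𝔻′-complement 0g)
                                   (cong₂ (λ o d → + 1 - o - d) 𝟙-0g
                                          (cong (λ b → if b then + 1 else + 0) 0g∉D)))
  ... | no g≢0g | inj₁ 𝔻g≡0 = inj₂ (trans (𝔻′-complement g) (cong₂ (λ o d → + 1 - o - d) (𝟙-≢0g g≢0g) 𝔻g≡0))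
  ... | no g≢0g | inj₂ 𝔻g≡1 = inj₁ (trans (𝔻′-complement g) (cong₂ (λ o d → + 1 - o - d) (𝟙-≢0g g≢0g) 𝔻g≡1))

  ∑𝔻 : ∑ 𝔻 ≡ + k
  ∑𝔻 = ∑⟪⟫ D

  ∑𝔻′ : ∑ 𝔻′ ≡ + k
  ∑𝔻′ = trans (∑-dil n₀ 𝔻) ∑𝔻

  2k≡v-1 : + 2 * + k ≡ + v - + 1
  2k≡v-1 = begin
    + 2 * + k            ≡⟨ double (+ k) ⟩
    + k + + k            ≡⟨ cong₂ _+_ ∑𝔻 ∑𝔻′ ⟨
    ∑ 𝔻 + ∑ 𝔻′           ≡⟨ sumL-+ elems 𝔻 𝔻′ ⟨
    ∑ (𝔻 ⊞ 𝔻′)           ≡⟨ sumL-cong elems 𝔻+𝔻′ ⟩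
    ∑ (𝔾 ⊟ 𝟙)            ≡⟨ trans (∑-⊟ 𝔾 𝟙) (cong₂ _-_ ∑-𝔾 ∑-𝟙) ⟩
    + v - + 1            ∎
    where
    open ≡-Reasoning
    double : ∀ i → + 2 * i ≡ i + i
    double = solve-∀

  -- The non-residue hypothesis only excludes the trivial group: modulo
  -- 1 every integer is a square.
  k≢0 : k ≢ 0
  k≢0 k≡0 with proj₁ gshds
  ... | e , (0<e , _ , e-minimal) , (_ , n₀-non-square) =
    n₀-non-square (+ 0 , subst (λ m → m ℕ.∣ ℤ.∣ + 0 * + 0 - n₀ ∣) (sym e≡1) (ℕ.1∣ _))
    where
    v≡1 : v ≡ 1
    v≡1 = ℤ.+-injective (ℤ.i-j≡0⇒i≡j (+ v) (+ 1)
            (trans (sym 2k≡v-1) (cong (λ m → + 2 * + m) k≡0)))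
    trivial : ∀ g → g ≡ 0g
    trivial g = singleton elems v≡1 (elems-complete g) (elems-complete 0g)
      where
      singleton : ∀ xs → length xs ≡ 1 → ∀ {a b} → a ∈ xs → b ∈ xs → a ≡ b
      singleton (x ∷ []) _ (here refl) (here refl) = refl
    e≡1 : e ≡ 1
    e≡1 = ℕ.≤-antisym (e-minimal 1 (s≤s z≤n) (λ g → trivial _)) 0<e

  ‾𝔻+‾𝔻′ : ‾ 𝔻 ⊞ ‾ 𝔻′ ≋ 𝔾 ⊟ 𝟙
  ‾𝔻+‾𝔻′ g = trans (𝔻+𝔻′ (⊖ g)) (cong (_-_ (+ 1)) (‾𝟙 g))

  ‾𝔻‾𝔻′ : ‾ 𝔻 ⊛ ‾ 𝔻′ ≋ c • 𝟙 ⊞ lam • 𝔾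
  ‾𝔻‾𝔻′ g = trans (sym (‾-⊛ 𝔻 𝔻′ g))
                  (trans (𝔻𝔻′ (⊖ g)) (cong (λ o → c * o + lam * + 1) (‾𝟙 g)))

  κ : ℤ
  κ = + k - lam

  square-relation : ∀ {X Y} → X ⊞ Y ≋ 𝔾 ⊟ 𝟙 → X ⊛ Y ≋ c • 𝟙 ⊞ lam • 𝔾 → ∑ X ≡ + k →
                    X ⊛ X ≋ ι κ ⊛ 𝔾 ⊟ X ⊟ ι c
  square-relation {X} X+Y XY ∑X g =
    trans (⊛-self-of-complement c lam X+Y XY g)
          (cong (λ s → s - X g - c * 𝟙 g)
                (trans (cong (_- lam) ∑X) (sym (trans (ι-⊛ κ 𝔾 g) (ℤ.*-identityʳ κ)))))

  T ε : R
  T = 𝔾 ⊟ ι (+ 1) ⊟ 𝔻 ⊟ ‾ 𝔻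
  ε = 𝔻 ⊟ ‾ 𝔻

  𝔻² : 𝔻 ⊛ 𝔻 ≋ ι κ ⊛ 𝔾 ⊟ 𝔻 ⊟ ι c
  𝔻² = square-relation 𝔻+𝔻′ 𝔻𝔻′ ∑𝔻

  ‾𝔻² : ‾ 𝔻 ⊛ ‾ 𝔻 ≋ ι κ ⊛ 𝔾 ⊟ ‾ 𝔻 ⊟ ι c
  ‾𝔻² = square-relation ‾𝔻+‾𝔻′ ‾𝔻‾𝔻′ (trans (∑-⊖ 𝔻) ∑𝔻)

  ε𝔾≋𝟘 : ε ⊛ 𝔾 ≋ 𝟘
  ε𝔾≋𝟘 g = trans (⊛-𝔾 ε g) (trans (∑-⊟ 𝔻 (‾ 𝔻))
                   (trans (cong₂ _-_ ∑𝔻 (trans (∑-⊖ 𝔻) ∑𝔻)) (ℤ.+-inverseʳ (+ k))))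

  T𝔾≋𝟘 : T ⊛ 𝔾 ≋ 𝟘
  T𝔾≋𝟘 g = begin
    (T ⊛ 𝔾) g
      ≡⟨ ⊛-𝔾 T g ⟩
    ∑ T
      ≡⟨ trans (∑-⊟ _ (‾ 𝔻)) (cong (_- ∑ (‾ 𝔻)) (trans (∑-⊟ _ 𝔻) (cong (_- ∑ 𝔻) (∑-⊟ 𝔾 (ι (+ 1)))))) ⟩
    ∑ 𝔾 - ∑ (ι (+ 1)) - ∑ 𝔻 - ∑ (‾ 𝔻)
      ≡⟨ cong₂ (λ a b → a - ∑ (ι (+ 1)) - b - ∑ (‾ 𝔻)) ∑-𝔾 ∑𝔻 ⟩
    + v - ∑ (ι (+ 1)) - + k - ∑ (‾ 𝔻)
      ≡⟨ cong₂ (λ a b → + v - a - + k - b) (∑-ι (+ 1)) (trans (∑-⊖ 𝔻) ∑𝔻) ⟩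
    + v - + 1 - + k - + k
      ≡⟨ regroup (+ v - + 1) (+ k) ⟩
    (+ v - + 1) - + 2 * + k
      ≡⟨ ℤ.i≡j⇒i-j≡0 (sym 2k≡v-1) ⟩
    + 0
      ∎
    where
    open ≡-Reasoning
    regroup : ∀ a b → a - b - b ≡ a - + 2 * b
    regroup = solve-∀

  εT≋𝟘 : ε ⊛ T ≋ 𝟘
  εT≋𝟘 = ≋𝟘-by
    (solve 5 (λ e b g q c →
        (e :- b) :* (g :- con (+ 1) :- e :- b)
      := (e :- b) :* g :- (e :* e :- (q :* g :- e :- c)) :+ (b :* b :- (q :* g :- b :- c)))
      (λ _ → refl) 𝔻 (‾ 𝔻) 𝔾 (ι κ) (ι c))
    (𝟘-⊞ (𝟘-⊟ ε𝔾≋𝟘 (≋⇒⊟≋𝟘 𝔻²)) (≋⇒⊟≋𝟘 ‾𝔻²))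

  Δ μ : R
  Δ = ι (+ 1) ⊟ ι (+ 4) ⊛ ι c
  μ = 𝔾 ⊟ ι (+ 2) ⊟ ι (+ 2) ⊛ (𝔻 ⊞ ‾ 𝔻) ⊞ ι (+ 4) ⊛ ι κ

  -- T² + ε² has no cross term 𝔻 ‾𝔻, so it is determined by the squares of 𝔻 and ‾𝔻.
  T²+ε² : T ⊛ T ⊞ ε ⊛ ε ≋ Δ ⊞ μ ⊛ 𝔾
  T²+ε² = ⊟≋𝟘⇒≋ (≋𝟘-by
    (solve 5 (λ e b g q c →
        (g :- con (+ 1) :- e :- b) :* (g :- con (+ 1) :- e :- b) :+ (e :- b) :* (e :- b)
          :- ((con (+ 1) :- con (+ 4) :* c) :+ (g :- con (+ 2) :- con (+ 2) :* (e :+ b) :+ con (+ 4) :* q) :* g)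
      := con (+ 2) :* (e :* e :- (q :* g :- e :- c)) :+ con (+ 2) :* (b :* b :- (q :* g :- b :- c)))
      (λ _ → refl) 𝔻 (‾ 𝔻) 𝔾 (ι κ) (ι c))
    (𝟘-⊞ (𝟘-⊛ (ι (+ 2)) (≋⇒⊟≋𝟘 𝔻²)) (𝟘-⊛ (ι (+ 2)) (≋⇒⊟≋𝟘 ‾𝔻²))))

  open FourthPowers T ε Δ μ εT≋𝟘 T𝔾≋𝟘 ε𝔾≋𝟘 T²+ε²

  δ : ℤ
  δ = + 1 - + 4 * c

  Δ⊛≋δ• : ∀ S → Δ ⊛ S ≋ δ • S
  Δ⊛≋δ• S g = trans (⊛-congˡ S Δ≋ιδ g) (ι-⊛ δ S g)
    where
    collect : ∀ o c → + 1 * o - + 4 * (c * o) ≡ (+ 1 - + 4 * c) * o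
    collect = solve-∀
    Δ≋ιδ : Δ ≋ ι δ
    Δ≋ιδ g = trans (cong (_-_ (+ 1 * 𝟙 g)) (ι-⊛ (+ 4) (ι c) g)) (collect (𝟙 g) c)

  ‾T≋T : ‾ T ≋ T
  ‾T≋T g = trans (cong₂ (λ o d → + 1 - + 1 * o - 𝔻 (⊖ g) - 𝔻 d) (‾𝟙 g) (⊖-involutive g))
                 (swap (𝟙 g) (𝔻 (⊖ g)) (𝔻 g))
    where
    swap : ∀ o a b → + 1 - + 1 * o - a - b ≡ + 1 - + 1 * o - b - a
    swap = solve-∀

  ‾ε≋-ε : ∀ g → ε (⊖ g) ≡ - ε g
  ‾ε≋-ε g = trans (cong (λ d → 𝔻 (⊖ g) - 𝔻 d) (⊖-involutive g)) (flip (𝔻 g) (𝔻 (⊖ g)))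
    where
    flip : ∀ a b → b - a ≡ - (a - b)
    flip = solve-∀

  0≤δ*sumSqT : + 0 ≤ δ * sumSq T
  0≤δ*sumSqT = subst (λ x → + 0 ≤ δ * x) T²-0g
                     (0≤Δ*S0g δ ‾T²≋T² (λ g → trans (T⁴≋ΔT² g) (Δ⊛≋δ• (T ⊛ T) g)))
    where
    T²-0g : (T ⊛ T) 0g ≡ sumSq T
    T²-0g = trans (⊛-congʳ T (λ g → sym (‾T≋T g)) 0g) (⊛‾-0g T)
    ‾T²≋T² : ‾ (T ⊛ T) ≋ T ⊛ T
    ‾T²≋T² g = trans (‾-⊛ T T g) (trans (⊛-congˡ (‾ T) ‾T≋T g) (⊛-congʳ T ‾T≋T g))

  0≤δ*-sumSqε : + 0 ≤ δ * - sumSq ε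
  0≤δ*-sumSqε = subst (λ x → + 0 ≤ δ * x) ε²-0g
                      (0≤Δ*S0g δ ‾ε²≋ε² (λ g → trans (ε⁴≋Δε² g) (Δ⊛≋δ• (ε ⊛ ε) g)))
    where
    ε²-0g : (ε ⊛ ε) 0g ≡ - sumSq ε
    ε²-0g = trans (⊛-0g ε ε) (trans (sumL-cong elems (λ h → trans (cong (ε h *_) (‾ε≋-ε h))
                                                                   (sym (ℤ.neg-distribʳ-* (ε h) (ε h)))))
                                    (sumL-neg elems _))
    ‾ε²≋ε² : ‾ (ε ⊛ ε) ≋ ε ⊛ ε
    ‾ε²≋ε² g = trans (‾-⊛ ε ε g) (sumL-cong elems (λ h →
      trans (cong₂ _*_ (‾ε≋-ε h) (‾ε≋-ε (g ─ h))) (neg*neg (ε h) (ε (g ─ h)))))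
      where
      neg*neg : ∀ a b → - a * - b ≡ a * b
      neg*neg = solve-∀

  symmetric⊎skew : ‾ 𝔻 ≋ 𝔻 ⊎ ‾ 𝔻 ≋ 𝔻′
  symmetric⊎skew with ℤ.<-cmp δ (+ 0)
  ... | tri≈ _ δ≡0 _ = ⊥-elim (1-4i≢0 c δ≡0)
  ... | tri> _ _ 0<δ = inj₁ (λ g → sym (ℤ.i-j≡0⇒i≡j (𝔻 g) (𝔻 (⊖ g)) (ε≋𝟘 g)))
    where
    ε≋𝟘 : ε ≋ 𝟘
    ε≋𝟘 = sumSq≡0⇒≋𝟘 ε (ℤ.≤-antisym (ℤ.neg-cancel-≤ (0<i⇒0≤i*j⇒0≤j 0<δ 0≤δ*-sumSqε)) (0≤sumSq ε))
  ... | tri< δ<0 _ _ = inj₂ (λ g → trans (sym (ℤ.i-j≡0⇒i≡j _ (𝔻 (⊖ g)) (T≋𝟘 g)))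
                                         (trans (cong (λ o → + 1 - o - 𝔻 g) (ℤ.*-identityˡ (𝟙 g)))
                                                (sym (𝔻′-complement g))))
    where
    T≋𝟘 : T ≋ 𝟘
    T≋𝟘 = sumSq≡0⇒≋𝟘 T (ℤ.≤-antisym (i<0⇒0≤i*j⇒j≤0 δ<0 0≤δ*sumSqT) (0≤sumSq T))

  symmetric⇒κ₀≡0 : ‾ 𝔻 ≋ 𝔻 → κ₀ ≡ 0
  symmetric⇒κ₀≡0 ‾𝔻≋𝔻 = card-∅ D∩D⁽⁻ⁿ⁾≡∅
    where
    𝔻′[⊖g]≤0 : ∀ g → D g ≡ true → 𝔻′ (⊖ g) ≤ + 0
    𝔻′[⊖g]≤0 g Dg = subst (_≤ + 0) (sym 𝔻′[⊖g]≡-𝟙) (ℤ.neg-mono-≤ (0≤⟪⟫ (λ x → does (x ≟ 0g)) (⊖ g)))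
      where
      𝔻′[⊖g]≡-𝟙 : 𝔻′ (⊖ g) ≡ - 𝟙 (⊖ g)
      𝔻′[⊖g]≡-𝟙 = trans (𝔻′-complement (⊖ g))
        (trans (cong (λ d → + 1 - 𝟙 (⊖ g) - d) (trans (‾𝔻≋𝔻 g) (cong (λ b → if b then + 1 else + 0) Dg)))
               (cancel (𝟙 (⊖ g))))
        where
        cancel : ∀ o → + 1 - o - + 1 ≡ - o
        cancel = solve-∀
    D∩D⁽⁻ⁿ⁾≡∅ : ∀ g → _∩_ G D (image G (- n₀) D) g ≡ false
    D∩D⁽⁻ⁿ⁾≡∅ g with D g in Dg | image G (- n₀) D g in g∈D⁽⁻ⁿ⁾
    ... | false | _     = refl
    ... | true  | false = refl
    ... | true  | true  with +≤+ () ← ℤ.≤-trans (image-neg⇒1≤dil n₀ D g g∈D⁽⁻ⁿ⁾) (𝔻′[⊖g]≤0 g Dg)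

  skew⇒κ₀≡k : ‾ 𝔻 ≋ 𝔻′ → κ₀ ≡ k
  skew⇒κ₀≡k ‾𝔻≋𝔻′ = card-cong D∩D⁽⁻ⁿ⁾≗D
    where
    D∩D⁽⁻ⁿ⁾≗D : ∀ g → _∩_ G D (image G (- n₀) D) g ≡ D g
    D∩D⁽⁻ⁿ⁾≗D g with D g in Dg
    ... | false = refl
    ... | true  = dil≢0⇒image-neg n₀ D g 𝔻′[⊖g]≢0
      where
      𝔻′[⊖g]≢0 : 𝔻′ (⊖ g) ≢ + 0
      𝔻′[⊖g]≢0 eq with () ← trans (sym (cong (λ b → if b then + 1 else + 0) Dg))
                                  (trans (cong 𝔻 (sym (⊖-involutive g))) (trans (‾𝔻≋𝔻′ (⊖ g)) eq))

  k²≡c+lam*v : + k * + k ≡ c + lam * + v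
  k²≡c+lam*v = begin
    + k * + k                      ≡⟨ cong₂ _*_ ∑𝔻 ∑𝔻′ ⟨
    ∑ 𝔻 * ∑ 𝔻′                     ≡⟨ ∑-⊛ 𝔻 𝔻′ ⟨
    ∑ (𝔻 ⊛ 𝔻′)                     ≡⟨ sumL-cong elems 𝔻𝔻′ ⟩
    ∑ (c • 𝟙 ⊞ lam • 𝔾)            ≡⟨ sumL-+ elems (c • 𝟙) (lam • 𝔾) ⟩
    ∑ (c • 𝟙) + ∑ (lam • 𝔾)        ≡⟨ cong₂ _+_ (∑-ι c) (sumL-*ˡ elems lam 𝔾) ⟩
    c + lam * ∑ 𝔾                  ≡⟨ cong (λ s → c + lam * s) ∑-𝔾 ⟩
    c + lam * + v                  ∎
    where open ≡-Reasoning

  k*[k-2lam]≡κ₀ : + k * (+ k - + 2 * lam) ≡ + κ₀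
  k*[k-2lam]≡κ₀ = begin
    + k * (+ k - + 2 * lam)                          ≡⟨ expand (+ k) lam ⟩
    + k * + k - + 2 * + k * lam                      ≡⟨ cong (_- + 2 * + k * lam) k²≡c+lam*v ⟩
    c + lam * + v - + 2 * + k * lam                  ≡⟨ cong (λ w → c + lam * w - + 2 * + k * lam) v≡2k+1 ⟩
    + κ₀ - lam + lam * (+ 2 * + k + + 1) - + 2 * + k * lam  ≡⟨ cancel (+ κ₀) lam (+ k) ⟩
    + κ₀                                             ∎
    where
    open ≡-Reasoning
    expand : ∀ k l → k * (k - + 2 * l) ≡ k * k - + 2 * k * l
    expand = solve-∀
    cancel : ∀ κ l k → κ - l + l * (+ 2 * k + + 1) - + 2 * k * l ≡ κ
    cancel = solve-∀
    v≡2k+1 : + v ≡ + 2 * + k + + 1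
    v≡2k+1 = i-j≡k⇒i≡k+j (+ v) (+ 1) _ (sym 2k≡v-1)

  κ₀≡0⇒k≡2lam : κ₀ ≡ 0 → + k ≡ + 2 * lam
  κ₀≡0⇒k≡2lam κ₀≡0 with ℤ.i*j≡0⇒i≡0∨j≡0 (+ k) (trans k*[k-2lam]≡κ₀ (cong +_ κ₀≡0))
  ... | inj₁ k≡0         = ⊥-elim (k≢0 (ℤ.+-injective k≡0))
  ... | inj₂ k-2lam≡0    = ℤ.i-j≡0⇒i≡j (+ k) (+ 2 * lam) k-2lam≡0

  κ₀≡k⇒k≡1+2lam : κ₀ ≡ k → + k ≡ + 1 + + 2 * lam
  κ₀≡k⇒k≡1+2lam κ₀≡k = i-j≡k⇒i≡k+j (+ k) (+ 2 * lam) (+ 1) k-2lam≡1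
    where
    instance
      k-nonZero : ℤ.NonZero (+ k)
      k-nonZero = ℤ.≢-nonZero (λ k≡0 → k≢0 (ℤ.+-injective k≡0))
    k-2lam≡1 : + k - + 2 * lam ≡ + 1
    k-2lam≡1 = ℤ.*-cancelˡ-≡ (+ k) _ (+ 1)
                 (trans k*[k-2lam]≡κ₀ (trans (cong +_ κ₀≡k) (sym (ℤ.*-identityʳ (+ k)))))

  κ₀≡0⊎κ₀≡k : κ₀ ≡ 0 ⊎ κ₀ ≡ k
  κ₀≡0⊎κ₀≡k with symmetric⊎skew
  ... | inj₁ symmetric = inj₁ (symmetric⇒κ₀≡0 symmetric)
  ... | inj₂ skew      = inj₂ (skew⇒κ₀≡k skew)

  κ₀≡0⇒symmetric : κ₀ ≡ 0 → ‾ 𝔻 ≋ 𝔻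
  κ₀≡0⇒symmetric κ₀≡0 with symmetric⊎skew
  ... | inj₁ symmetric = symmetric
  ... | inj₂ skew      = ⊥-elim (k≢0 (trans (sym (skew⇒κ₀≡k skew)) κ₀≡0))

  κ₀≡k⇒skew : κ₀ ≡ k → ‾ 𝔻 ≋ 𝔻′
  κ₀≡k⇒skew κ₀≡k with symmetric⊎skew
  ... | inj₁ symmetric = ⊥-elim (k≢0 (trans (sym κ₀≡k) (symmetric⇒κ₀≡0 symmetric)))
  ... | inj₂ skew      = skew

  paley : κ₀ ≡ 0 →
          (+ 2 * + k ≡ + v - + 1)
          × ∃ λ lam' → ∃ λ mu → (+ 4 * lam' ≡ + v - + 5) × (+ 4 * mu ≡ + v - + 1)
          × IsPDS G D (+ v) (+ k) lam' mu
  paley κ₀≡0 = 2k≡v-1 , lam - + 1 , lam ,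
                 trans (four-l-1 lam) (cong (_- + 5) (sym v≡4lam+1)) ,
                 trans (four-l lam) (cong (_- + 1) (sym v≡4lam+1)) ,
                 refl , refl , 0g∉D , (λ g → indicator-injective (‾𝔻≋𝔻 g)) , 𝔻‾𝔻
    where
    ‾𝔻≋𝔻 : ‾ 𝔻 ≋ 𝔻
    ‾𝔻≋𝔻 = κ₀≡0⇒symmetric κ₀≡0
    k≡2lam : + k ≡ + 2 * lam
    k≡2lam = κ₀≡0⇒k≡2lam κ₀≡0
    v≡4lam+1 : + v ≡ + 4 * lam + + 1
    v≡4lam+1 = i-j≡k⇒i≡k+j (+ v) (+ 1) _ (trans (sym 2k≡v-1) (trans (cong (+ 2 *_) k≡2lam) (double lam)))
      where
      double : ∀ l → + 2 * (+ 2 * l) ≡ + 4 * l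
      double = solve-∀
    four-l-1 : ∀ l → + 4 * (l - + 1) ≡ + 4 * l + + 1 - + 5
    four-l-1 = solve-∀
    four-l : ∀ l → + 4 * l ≡ + 4 * l + + 1 - + 1
    four-l = solve-∀
    𝔻‾𝔻 : ∀ g → (𝔻 ⊛ dil G (- + 1) 𝔻) g
               ≡ + k * 𝟙 g + ((lam - + 1) * 𝔻 g + lam * (+ 1 - 𝟙 g - 𝔻 g))
    𝔻‾𝔻 g = begin
      (𝔻 ⊛ dil G (- + 1) 𝔻) g
        ≡⟨ ⊛-congʳ 𝔻 (λ x → trans (dil-neg 𝔻 x) (‾𝔻≋𝔻 x)) g ⟩
      (𝔻 ⊛ 𝔻) g
        ≡⟨ ⊛-self-of-complement c lam 𝔻+𝔻′ 𝔻𝔻′ g ⟩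
      ∑ 𝔻 - lam - 𝔻 g - (+ κ₀ - lam) * 𝟙 g
        ≡⟨ cong₂ (λ s κ → s - lam - 𝔻 g - (+ κ - lam) * 𝟙 g) ∑𝔻 κ₀≡0 ⟩
      + k - lam - 𝔻 g - (+ 0 - lam) * 𝟙 g
        ≡⟨ subst (λ K → K - lam - 𝔻 g - (+ 0 - lam) * 𝟙 g
                        ≡ K * 𝟙 g + ((lam - + 1) * 𝔻 g + lam * (+ 1 - 𝟙 g - 𝔻 g)))
                 (sym k≡2lam) (rearrange lam (𝔻 g) (𝟙 g)) ⟩
      + k * 𝟙 g + ((lam - + 1) * 𝔻 g + lam * (+ 1 - 𝟙 g - 𝔻 g))
        ∎
      where
      open ≡-Reasoning
      rearrange : ∀ l d o → + 2 * l - l - d - (+ 0 - l) * o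
                            ≡ + 2 * l * o + ((l - + 1) * d + l * (+ 1 - o - d))
      rearrange = solve-∀

  skewHadamard : κ₀ ≡ k →
                 (+ 2 * + k ≡ + v - + 1)
                 × ∃ λ lam'' → (+ 4 * lam'' ≡ + v - + 3)
                 × IsSkewHadamardDS G D (+ v) (+ k) lam''
  skewHadamard κ₀≡k = 2k≡v-1 , lam , 4lam≡v-3 , refl , refl , 𝔻‾𝔻 , 𝔻+‾𝔻
    where
    ‾𝔻≋𝔻′ : ∀ g → dil G (- + 1) 𝔻 g ≡ 𝔻′ g
    ‾𝔻≋𝔻′ g = trans (dil-neg 𝔻 g) (κ₀≡k⇒skew κ₀≡k g)
    4lam≡v-3 : + 4 * lam ≡ + v - + 3
    4lam≡v-3 = trans (rearrange lam)
      (cong (_- + 3) (trans (cong (λ K → + 2 * K + + 1) (sym (κ₀≡k⇒k≡1+2lam κ₀≡k)))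
                            (sym (i-j≡k⇒i≡k+j (+ v) (+ 1) _ (sym 2k≡v-1)))))
      where
      rearrange : ∀ l → + 4 * l ≡ + 2 * (+ 1 + + 2 * l) + + 1 - + 3
      rearrange = solve-∀
    𝔻‾𝔻 : ∀ g → (𝔻 ⊛ dil G (- + 1) 𝔻) g ≡ (+ k - lam) * 𝟙 g + lam * + 1
    𝔻‾𝔻 g = trans (⊛-congʳ 𝔻 ‾𝔻≋𝔻′ g)
                  (trans (𝔻𝔻′ g) (cong (λ n → (+ n - lam) * 𝟙 g + lam * + 1) κ₀≡k))
    𝔻+‾𝔻 : ∀ g → 𝔻 g + dil G (- + 1) 𝔻 g ≡ + 1 - 𝟙 g
    𝔻+‾𝔻 g = trans (cong (_+_ (𝔻 g)) (‾𝔻≋𝔻′ g)) (𝔻+𝔻′ g)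

  𝔹 : Fin 3 → R
  𝔹 = basisA G D n₀

  coordinates : ℤ → ℤ → ℤ → Fin 3 → ℤ
  coordinates a b d 0F = a
  coordinates a b d 1F = b
  coordinates a b d 2F = d

  partition : ∀ g → sumFin 3 (λ i → 𝔹 i g) ≡ + 1
  partition g = trans (regroup (𝟙 g) (𝔻 g) (𝔻′ g)) (trans (cong (_+_ (𝟙 g)) (𝔻+𝔻′ g)) (cancel (𝟙 g)))
    where
    regroup : ∀ o x y → o + (x + (y + + 0)) ≡ o + (x + y)
    regroup = solve-∀
    cancel : ∀ o → o + (+ 1 - o) ≡ + 1
    cancel = solve-∀

  combination : (Fin 3 → ℤ) → R
  combination cs g = sumFin 3 (λ l → cs l * 𝔹 l g)

  constant-in-basis : ∀ a g → a ≡ combination (coordinates a a a) g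
  constant-in-basis a g = trans (sym (ℤ.*-identityʳ a))
                                (trans (cong (a *_) (sym (partition g))) (distrib a (𝟙 g) (𝔻 g) (𝔻′ g)))
    where
    distrib : ∀ a o x y → a * (o + (x + (y + + 0))) ≡ a * o + (a * x + (a * y + + 0))
    distrib = solve-∀

  ⊛-self-in-basis : ∀ {X Y} → X ⊞ Y ≋ 𝔾 ⊟ 𝟙 → X ⊛ Y ≋ c • 𝟙 ⊞ lam • 𝔾 → ∑ X ≡ + k →
                    ∀ g → (X ⊛ X) g ≡ combination (coordinates κ κ κ) g - X g - c * 𝟙 g
  ⊛-self-in-basis {X} X+Y XY ∑X g =
    trans (⊛-self-of-complement c lam X+Y XY g)
          (cong (λ s → s - X g - c * 𝟙 g) (trans (cong (_- lam) ∑X) (constant-in-basis κ g)))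

  unit : Fin 3 → Fin 3 → ℤ
  unit 0F = coordinates (+ 1) (+ 0) (+ 0)
  unit 1F = coordinates (+ 0) (+ 1) (+ 0)
  unit 2F = coordinates (+ 0) (+ 0) (+ 1)

  𝔹≋combination-unit : ∀ j → 𝔹 j ≋ combination (unit j)
  𝔹≋combination-unit 0F g = e₀ (𝟙 g) (𝔻 g) (𝔻′ g)
    where
    e₀ : ∀ o x y → o ≡ + 1 * o + (+ 0 * x + (+ 0 * y + + 0))
    e₀ = solve-∀
  𝔹≋combination-unit 1F g = e₁ (𝟙 g) (𝔻 g) (𝔻′ g)
    where
    e₁ : ∀ o x y → x ≡ + 0 * o + (+ 1 * x + (+ 0 * y + + 0))
    e₁ = solve-∀
  𝔹≋combination-unit 2F g = e₂ (𝟙 g) (𝔻 g) (𝔻′ g)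
    where
    e₂ : ∀ o x y → y ≡ + 0 * o + (+ 0 * x + (+ 1 * y + + 0))
    e₂ = solve-∀

  𝔻𝔻′-in-basis : 𝔻 ⊛ 𝔻′ ≋ combination (coordinates (c + lam) lam lam)
  𝔻𝔻′-in-basis g =
    trans (𝔻𝔻′ g) (trans (cong (λ l → c * 𝟙 g + l) (trans (ℤ.*-identityʳ lam) (constant-in-basis lam g)))
                         (collect c lam (𝟙 g) (𝔻 g) (𝔻′ g)))
    where
    collect : ∀ c l o x y → c * o + (l * o + (l * x + (l * y + + 0)))
                            ≡ (c + l) * o + (l * x + (l * y + + 0))
    collect = solve-∀

  basis-closed : ∀ i j → ∃ λ (cs : Fin 3 → ℤ) → 𝔹 i ⊛ 𝔹 j ≋ combination cs
  basis-closed 0F j  = unit j , λ g → trans (⊛-identityˡ (𝔹 j) g) (𝔹≋combination-unit j g)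
  basis-closed 1F 0F = unit 1F , λ g → trans (⊛-identityʳ 𝔻 g) (𝔹≋combination-unit 1F g)
  basis-closed 2F 0F = unit 2F , λ g → trans (⊛-identityʳ 𝔻′ g) (𝔹≋combination-unit 2F g)
  basis-closed 1F 1F = coordinates (κ - c) (κ - + 1) κ , λ g →
    trans (⊛-self-in-basis 𝔻+𝔻′ 𝔻𝔻′ ∑𝔻 g) (collect κ c (𝟙 g) (𝔻 g) (𝔻′ g))
    where
    collect : ∀ κ c o x y → κ * o + (κ * x + (κ * y + + 0)) - x - c * o
                            ≡ (κ - c) * o + ((κ - + 1) * x + (κ * y + + 0))
    collect = solve-∀
  basis-closed 1F 2F = coordinates (c + lam) lam lam , 𝔻𝔻′-in-basis
  basis-closed 2F 1F = coordinates (c + lam) lam lam , λ g → trans (⊛-comm 𝔻′ 𝔻 g) (𝔻𝔻′-in-basis g)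
  basis-closed 2F 2F = coordinates (κ - c) κ (κ - + 1) , λ g →
    trans (⊛-self-in-basis (λ g → trans (ℤ.+-comm (𝔻′ g) (𝔻 g)) (𝔻+𝔻′ g))
                           (λ g → trans (⊛-comm 𝔻′ 𝔻 g) (𝔻𝔻′ g)) ∑𝔻′ g)
          (collect κ c (𝟙 g) (𝔻 g) (𝔻′ g))
    where
    collect : ∀ κ c o x y → κ * o + (κ * x + (κ * y + + 0)) - y - c * o
                            ≡ (κ - c) * o + (κ * x + ((κ - + 1) * y + + 0))
    collect = solve-∀

  ‾-basis : ∀ i → ∃ λ j → dil G (- + 1) (𝔹 i) ≋ 𝔹 j
  ‾-basis 0F = 0F , λ g → trans (dil-neg 𝟙 g) (‾𝟙 g)
  ‾-basis 1F with symmetric⊎skew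
  ... | inj₁ ‾𝔻≋𝔻  = 1F , λ g → trans (dil-neg 𝔻 g) (‾𝔻≋𝔻 g)
  ... | inj₂ ‾𝔻≋𝔻′ = 2F , λ g → trans (dil-neg 𝔻 g) (‾𝔻≋𝔻′ g)
  ‾-basis 2F with symmetric⊎skew
  ... | inj₁ ‾𝔻≋𝔻  = 2F , λ g → trans (dil-neg 𝔻′ g)
      (trans (𝔻′-complement (⊖ g))
             (trans (cong₂ (λ o d → + 1 - o - d) (‾𝟙 g) (‾𝔻≋𝔻 g)) (sym (𝔻′-complement g))))
  ... | inj₂ ‾𝔻≋𝔻′ = 1F , λ g → trans (dil-neg 𝔻′ g)
      (sym (trans (cong 𝔻 (sym (⊖-involutive g))) (‾𝔻≋𝔻′ (⊖ g))))

  schurRing : IsSchurRing G 2 𝔹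
  schurRing = (λ _ → refl) , 01-valued , nonempty , partition , ‾-basis , basis-closed
    where
    01-valued : ∀ i g → 𝔹 i g ≡ + 0 ⊎ 𝔹 i g ≡ + 1
    01-valued 0F = ⟪⟫-01 (λ x → does (x ≟ 0g))
    01-valued 1F = ⟪⟫-01 D
    01-valued 2F = 𝔻′-01
    nonempty : ∀ i → ∃ λ g → 𝔹 i g ≡ + 1
    nonempty 0F = 0g , 𝟙-0g
    nonempty 1F = ∃-unit-of-∑≢0 (⟪⟫-01 D) (λ ∑≡0 → k≢0 (ℤ.+-injective (trans (sym ∑𝔻) ∑≡0)))
    nonempty 2F = ∃-unit-of-∑≢0 𝔻′-01 (λ ∑≡0 → k≢0 (ℤ.+-injective (trans (sym ∑𝔻′) ∑≡0)))

proposition3 : (G : FinAbGroup) (D : Subset G) (n₀ lam : ℤ) →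
    IsGSHDS G D n₀ lam →
      IsSchurRing G 2 (basisA G D n₀)
    × ((k₀ G n₀ D ≡ 0) ⊎ (k₀ G n₀ D ≡ card G D))
    × (k₀ G n₀ D ≡ 0 →
         (+ 2 * + card G D ≡ + order G - + 1)
         × ∃ λ lam' → ∃ λ mu → (+ 4 * lam' ≡ + order G - + 5) × (+ 4 * mu ≡ + order G - + 1)
             × IsPDS G D (+ order G) (+ card G D) lam' mu)
    × (k₀ G n₀ D ≡ card G D →
         (+ 2 * + card G D ≡ + order G - + 1)
         × ∃ λ lam'' → (+ 4 * lam'' ≡ + order G - + 3)
             × IsSkewHadamardDS G D (+ order G) (+ card G D) lam'')
proposition3 G D n₀ lam gshds = schurRing , κ₀≡0⊎κ₀≡k , paley , skewHadamard
  where open GSHDS G D n₀ lam gshds
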